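{- Let $A=\mathbb{Z}[i]$ and $f$ a binary hermitian form over $\mathbb{Q}(i)$. Let $\mathbf r,\mathbf s\in A^2$ be primitive vectors spanning an $A$-submodule of index $2$ in $A^2$, and for $k=1,2,3,4$ put $\mathbf w_k=\frac{1+i}{2}(\mathbf r+i^k\mathbf s)$. Then $$2f(\mathbf r)+2f(\mathbf s)=\sum_{k=1}^4 f(\mathbf w_k),$$ i.e. twice the sum of the values of $f$ at two opposite regions at the corresponding vertex of the spine equals the sum of the values at the four remaining regions. In particular $f(\mathbf r)+f(\mathbf s)=f(\mathbf w_1)+f(\mathbf w_3)=f(\mathbf w_2)+f(\mathbf w_4)$, so the quantity $inv(v)=f(\mathbf r)+f(\mathbf s)$ does not depend on which pair of opposite regions at the vertex is used.
   Context: A binary hermitian form over $\mathbb{Q}(i)$ is $f(x,y)=aN(x)+cN(y)+\nu x\bar y+\bar\nu\bar x y$ with $a,c\in\mathbb{Q}$, $\nu\in\mathbb{Q}(i)$, $N(x)=|x|^2$. A vector in $A^2$ is primitive if its coordinates generate $A$. For $D=-4$ the vertices of Mendoza's spine correspond to such configurations: the six cusps whose regions contain a vertex correspond to the lax vectors $\mathbf r,\mathbf s,\mathbf w_1,\dots,\mathbf w_4$ (up to units), where $\{\mathbf r,\mathbf s\}$, $\{\mathbf w_1,\mathbf w_3\}$, $\{\mathbf w_2,\mathbf w_4\}$ are the pairs of opposite faces of the link cube. -}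

module Defs where

open import Data.Nat using (ℕ; zero; suc)
open import Data.Integer as ℤ using (ℤ)
open import Data.Rational as ℚ using (ℚ; 0ℚ; 1ℚ; ½)
open import Data.Product using (_×_; _,_; ∃-syntax)
open import Relation.Binary.PropositionalEquality using (_≡_)
open import Relation.Nullary using (¬_)
open import Data.Sum using (_⊎_)

record 𝔾 : Set where
  constructor _+i_
  field re im : ℤ
open 𝔾 public

infixl 6 _+ᴳ_ _-ᴳ_
infixl 7 _*ᴳ_

_+ᴳ_ : 𝔾 → 𝔾 → 𝔾
(a +i b) +ᴳ (c +i d) = (a ℤ.+ c) +i (b ℤ.+ d)

_-ᴳ_ : 𝔾 → 𝔾 → 𝔾
(a +i b) -ᴳ (c +i d) = (a ℤ.- c) +i (b ℤ.- d)

_*ᴳ_ : 𝔾 → 𝔾 → 𝔾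
(a +i b) *ᴳ (c +i d) = (a ℤ.* c ℤ.- b ℤ.* d) +i (a ℤ.* d ℤ.+ b ℤ.* c)

0ᴳ 1ᴳ : 𝔾
0ᴳ = ℤ.0ℤ +i ℤ.0ℤ
1ᴳ = ℤ.1ℤ +i ℤ.0ℤ

A² : Set
A² = 𝔾 × 𝔾

_+²_ : A² → A² → A²
(x , y) +² (x' , y') = (x +ᴳ x') , (y +ᴳ y')

_-²_ : A² → A² → A²
(x , y) -² (x' , y') = (x -ᴳ x') , (y -ᴳ y')

_·²_ : 𝔾 → A² → A²
α ·² (x , y) = (α *ᴳ x) , (α *ᴳ y)

Primitive : A² → Set
Primitive (x , y) = ∃[ u ] ∃[ v ] (u *ᴳ x +ᴳ v *ᴳ y ≡ 1ᴳ)

InSpan : A² → A² → A² → Set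
InSpan r s v = ∃[ α ] ∃[ β ] (v ≡ (α ·² r) +² (β ·² s))

-- the A-submodule spanned by r and s has index 2 in A²:
-- the quotient A² / ⟨r,s⟩ has exactly two elements, i.e. there is a
-- vector t not in the span such that every vector is congruent to 0 or to t.
SpanHasIndex2 : A² → A² → Set
SpanHasIndex2 r s =
  ∃[ t ] (¬ InSpan r s t × (∀ v → InSpan r s v ⊎ InSpan r s (v -² t)))

record ℚi : Set where
  constructor _+iℚ_
  field reℚ imℚ : ℚ
open ℚi public

infixl 6 _⊕_
infixl 7 _⊗_

_⊕_ : ℚi → ℚi → ℚi
(a +iℚ b) ⊕ (c +iℚ d) = (a ℚ.+ c) +iℚ (b ℚ.+ d)

_⊗_ : ℚi → ℚi → ℚi
(a +iℚ b) ⊗ (c +iℚ d) = (a ℚ.* c ℚ.- b ℚ.* d) +iℚ (a ℚ.* d ℚ.+ b ℚ.* c)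

conj : ℚi → ℚi
conj (a +iℚ b) = a +iℚ (ℚ.- b)

N : ℚi → ℚ
N (a +iℚ b) = a ℚ.* a ℚ.+ b ℚ.* b

ofℚ : ℚ → ℚi
ofℚ q = q +iℚ 0ℚ

iℚ : ℚi
iℚ = 0ℚ +iℚ 1ℚ

_^ᵢ_ : ℚi → ℕ → ℚi
z ^ᵢ zero = ofℚ 1ℚ
z ^ᵢ suc k = z ⊗ (z ^ᵢ k)

ι : 𝔾 → ℚi
ι (a +i b) = (a ℚ./ 1) +iℚ (b ℚ./ 1)

ℚi² : Set
ℚi² = ℚi × ℚi

ι² : A² → ℚi²
ι² (x , y) = ι x , ι y

_⊕²_ : ℚi² → ℚi² → ℚi²
(x , y) ⊕² (x' , y') = (x ⊕ x') , (y ⊕ y')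

_⊙²_ : ℚi → ℚi² → ℚi²
α ⊙² (x , y) = (α ⊗ x) , (α ⊗ y)

-- binary hermitian forms over ℚ(i):
--   f(x,y) = a N(x) + c N(y) + ν x ȳ + ν̄ x̄ y,  a c ∈ ℚ, ν ∈ ℚ(i)

record HermForm : Set where
  constructor hermForm
  field
    a c : ℚ
    ν   : ℚi

eval : HermForm → ℚi² → ℚi
eval (hermForm a c ν) (x , y) =
  ofℚ (a ℚ.* N x) ⊕ ofℚ (c ℚ.* N y) ⊕ (ν ⊗ x ⊗ conj y) ⊕ (conj ν ⊗ conj x ⊗ y)

w : A² → A² → ℕ → ℚi²
w r s k = ((½ +iℚ ½)) ⊙² (ι² r ⊕² ((iℚ ^ᵢ k) ⊙² ι² s))

two : ℚi
two = ofℚ (1ℚ ℚ.+ 1ℚ)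

-- Writing ζ for a unit i^k, the vectors w_k and w_{k+2} are (1+i)/2 · (r ± ζ s). A hermitian form
-- is homogeneous of degree N, f(α v) = N(α) f(v), and satisfies the parallelogram law
-- f(u + v) + f(u − v) = 2 f(u) + 2 f(v), the cross terms of u + v and u − v cancelling.
-- Since N((1+i)/2) = 1/2 and N(ζ) = 1, this gives f(w_k) + f(w_{k+2}) = f(r) + f(s) for every k,
-- and the identity for all four w_k is the sum of the cases k = 1 and k = 2.
module Submission where

open import Defs
open import Data.Fin using (Fin; zero; suc; #_)
open import Data.Nat.Base using (ℕ; zero; suc; _+_; _*_)
open import Data.Product.Base using (_×_; _,_; proj₁; proj₂)
open import Data.Rational.Base as ℚ using (ℚ; 1ℚ; ½)
open import Data.Rational.Properties using (*-identityˡ)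
open import Data.Rational.Solver using (module +-*-Solver)
open import Data.Vec.Base using (Vec; []; _∷_)
open import Relation.Binary.PropositionalEquality using (_≡_; refl; sym; trans; cong; cong₂; module ≡-Reasoning)

open +-*-Solver using (Polynomial; con; var; _:+_; _:*_; _:-_; :-_; ⟦_⟧; ⟦_⟧↓; prove)
open ≡-Reasoning

-ᵢ_ : ℚi → ℚi
-ᵢ (a +iℚ b) = (ℚ.- a) +iℚ (ℚ.- b)

-²_ : ℚi² → ℚi²
-² (x , y) = (-ᵢ x) , (-ᵢ y)

-- Identities in ℚ(i) are proved by the ring solver on real and imaginary parts: Expr k is a
-- symbolic ℚ(i) expression in k variables, and the symbolic operations below mirror those of
-- ℚ(i), so that ⟦_⟧ᵢ commutes with them definitionally.
record Expr (k : ℕ) : Set where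
  constructor _+iₑ_
  field
    reₑ imₑ : Polynomial (k * 2)

-- The real and imaginary parts of the i-th variable are the polynomial variables 2i and 2i+1.
reSlot imSlot : ∀ {k} → Fin k → Fin (k * 2)
reSlot zero    = zero
reSlot (suc i) = suc (suc (reSlot i))
imSlot zero    = suc zero
imSlot (suc i) = suc (suc (imSlot i))

varᵢ : ∀ {k} → Fin k → Expr k
varᵢ i = var (reSlot i) +iₑ var (imSlot i)

envᵢ : ∀ {k} → Vec ℚi k → Vec ℚ (k * 2)
envᵢ []       = []
envᵢ (z ∷ zs) = reℚ z ∷ imℚ z ∷ envᵢ zs

⟦_⟧ᵢ : ∀ {k} → Expr k → Vec ℚi k → ℚi
⟦ p +iₑ q ⟧ᵢ zs = ⟦ p ⟧ (envᵢ zs) +iℚ ⟦ q ⟧ (envᵢ zs)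

ℚi-prove : ∀ {k} (zs : Vec ℚi k) (e₁ e₂ : Expr k) →
  ⟦ Expr.reₑ e₁ ⟧↓ (envᵢ zs) ≡ ⟦ Expr.reₑ e₂ ⟧↓ (envᵢ zs) →
  ⟦ Expr.imₑ e₁ ⟧↓ (envᵢ zs) ≡ ⟦ Expr.imₑ e₂ ⟧↓ (envᵢ zs) →
  ⟦ e₁ ⟧ᵢ zs ≡ ⟦ e₂ ⟧ᵢ zs
ℚi-prove zs (p +iₑ q) (p′ +iₑ q′) re-eq im-eq =
  cong₂ _+iℚ_ (prove (envᵢ zs) p p′ re-eq) (prove (envᵢ zs) q q′ im-eq)

module _ {k : ℕ} where

  infixl 6 _⊕ₑ_
  infixl 7 _⊗ₑ_

  constₑ : ℚi → Expr k
  constₑ z = con (reℚ z) +iₑ con (imℚ z)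

  _⊕ₑ_ _⊗ₑ_ : Expr k → Expr k → Expr k
  (a +iₑ b) ⊕ₑ (c +iₑ d) = (a :+ c) +iₑ (b :+ d)
  (a +iₑ b) ⊗ₑ (c +iₑ d) = (a :* c :- b :* d) +iₑ (a :* d :+ b :* c)

  -ₑ_ conjₑ : Expr k → Expr k
  -ₑ (a +iₑ b) = (:- a) +iₑ (:- b)
  conjₑ (a +iₑ b) = a +iₑ (:- b)

  Nₑ : Expr k → Polynomial (k * 2)
  Nₑ (a +iₑ b) = a :* a :+ b :* b

  ofℚₑ : Polynomial (k * 2) → Expr k
  ofℚₑ q = q +iₑ con ℚ.0ℚ

  _⊕²ₑ_ : Expr k × Expr k → Expr k × Expr k → Expr k × Expr k
  (x , y) ⊕²ₑ (x′ , y′) = (x ⊕ₑ x′) , (y ⊕ₑ y′)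

  _⊙²ₑ_ : Expr k → Expr k × Expr k → Expr k × Expr k
  α ⊙²ₑ (x , y) = (α ⊗ₑ x) , (α ⊗ₑ y)

  -²ₑ_ : Expr k × Expr k → Expr k × Expr k
  -²ₑ (x , y) = (-ₑ x) , (-ₑ y)

  evalₑ : Expr k → Expr k → Expr k → Expr k × Expr k → Expr k
  evalₑ a c ν (x , y) =
    ofℚₑ (Expr.reₑ a :* Nₑ x) ⊕ₑ ofℚₑ (Expr.reₑ c :* Nₑ y)
      ⊕ₑ (ν ⊗ₑ x ⊗ₑ conjₑ y) ⊕ₑ (conjₑ ν ⊗ₑ conjₑ x ⊗ₑ y)

⊗-identityˡ : ∀ z → ofℚ 1ℚ ⊗ z ≡ z
⊗-identityˡ z = ℚi-prove (z ∷ []) (ofℚₑ (con 1ℚ) ⊗ₑ Z) Z refl refl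
  where
  Z : Expr 1
  Z = varᵢ (# 0)

⊗-distribˡ-⊕ : ∀ x y z → x ⊗ (y ⊕ z) ≡ x ⊗ y ⊕ x ⊗ z
⊗-distribˡ-⊕ x y z = ℚi-prove (x ∷ y ∷ z ∷ []) (X ⊗ₑ (Y ⊕ₑ Z)) (X ⊗ₑ Y ⊕ₑ X ⊗ₑ Z) refl refl
  where
  X Y Z : Expr 3
  X = varᵢ (# 0)
  Y = varᵢ (# 1)
  Z = varᵢ (# 2)

⊕-interchange : ∀ x y z t → (x ⊕ y) ⊕ (z ⊕ t) ≡ x ⊕ z ⊕ y ⊕ t
⊕-interchange x y z t =
  ℚi-prove (x ∷ y ∷ z ∷ t ∷ []) ((X ⊕ₑ Y) ⊕ₑ (Z ⊕ₑ T)) (X ⊕ₑ Z ⊕ₑ Y ⊕ₑ T) refl refl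
  where
  X Y Z T : Expr 4
  X = varᵢ (# 0)
  Y = varᵢ (# 1)
  Z = varᵢ (# 2)
  T = varᵢ (# 3)

two-⊗ : ∀ z → two ⊗ z ≡ z ⊕ z
two-⊗ z = ℚi-prove (z ∷ []) (constₑ two ⊗ₑ Z) (Z ⊕ₑ Z) refl refl
  where
  Z : Expr 1
  Z = varᵢ (# 0)

½-⊗-two-⊗ : ∀ z → ofℚ ½ ⊗ (two ⊗ z) ≡ z
½-⊗-two-⊗ z = ℚi-prove (z ∷ []) (constₑ (ofℚ ½) ⊗ₑ (constₑ two ⊗ₑ Z)) Z refl refl
  where
  Z : Expr 1
  Z = varᵢ (# 0)

iℚ-⊗-iℚ-⊗ : ∀ z → iℚ ⊗ (iℚ ⊗ z) ≡ -ᵢ z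
iℚ-⊗-iℚ-⊗ z = ℚi-prove (z ∷ []) (constₑ iℚ ⊗ₑ (constₑ iℚ ⊗ₑ Z)) (-ₑ Z) refl refl
  where
  Z : Expr 1
  Z = varᵢ (# 0)

-ᵢ-⊗ : ∀ x y → (-ᵢ x) ⊗ y ≡ -ᵢ (x ⊗ y)
-ᵢ-⊗ x y = ℚi-prove (x ∷ y ∷ []) ((-ₑ X) ⊗ₑ Y) (-ₑ (X ⊗ₑ Y)) refl refl
  where
  X Y : Expr 2
  X = varᵢ (# 0)
  Y = varᵢ (# 1)

N-⊗ : ∀ x y → N (x ⊗ y) ≡ N x ℚ.* N y
N-⊗ x y = prove (envᵢ (x ∷ y ∷ [])) (Nₑ (X ⊗ₑ Y)) (Nₑ X :* Nₑ Y) refl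
  where
  X Y : Expr 2
  X = varᵢ (# 0)
  Y = varᵢ (# 1)

N-iℚ^ : ∀ k → N (iℚ ^ᵢ k) ≡ 1ℚ
N-iℚ^ zero    = refl
N-iℚ^ (suc k) = trans (N-⊗ iℚ (iℚ ^ᵢ k)) (trans (*-identityˡ (N (iℚ ^ᵢ k))) (N-iℚ^ k))

-ᵢ-⊙² : ∀ ζ v → (-ᵢ ζ) ⊙² v ≡ -² (ζ ⊙² v)
-ᵢ-⊙² ζ (x , y) = cong₂ _,_ (-ᵢ-⊗ ζ x) (-ᵢ-⊗ ζ y)

eval-scale : ∀ f α v → eval f (α ⊙² v) ≡ ofℚ (N α) ⊗ eval f v
eval-scale (hermForm a c ν) α v =
  ℚi-prove (ofℚ a ∷ ofℚ c ∷ ν ∷ α ∷ proj₁ v ∷ proj₂ v ∷ [])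
    (F (Α ⊙²ₑ V)) (ofℚₑ (Nₑ Α) ⊗ₑ F V) refl refl
  where
  F : Expr 6 × Expr 6 → Expr 6
  F = evalₑ (varᵢ (# 0)) (varᵢ (# 1)) (varᵢ (# 2))
  Α : Expr 6
  Α = varᵢ (# 3)
  V : Expr 6 × Expr 6
  V = varᵢ (# 4) , varᵢ (# 5)

eval-parallelogram : ∀ f u v →
  eval f (u ⊕² v) ⊕ eval f (u ⊕² (-² v)) ≡ two ⊗ (eval f u ⊕ eval f v)
eval-parallelogram (hermForm a c ν) u v =
  ℚi-prove (ofℚ a ∷ ofℚ c ∷ ν ∷ proj₁ u ∷ proj₂ u ∷ proj₁ v ∷ proj₂ v ∷ [])
    (F (U ⊕²ₑ V) ⊕ₑ F (U ⊕²ₑ (-²ₑ V))) (constₑ two ⊗ₑ (F U ⊕ₑ F V)) refl refl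
  where
  F : Expr 7 × Expr 7 → Expr 7
  F = evalₑ (varᵢ (# 0)) (varᵢ (# 1)) (varᵢ (# 2))
  U V : Expr 7 × Expr 7
  U = varᵢ (# 3) , varᵢ (# 4)
  V = varᵢ (# 5) , varᵢ (# 6)

eval-opposite-pair : ∀ f α ζ u v →
  eval f (α ⊙² (u ⊕² (ζ ⊙² v))) ⊕ eval f (α ⊙² (u ⊕² ((-ᵢ ζ) ⊙² v)))
    ≡ ofℚ (N α) ⊗ (two ⊗ (eval f u ⊕ ofℚ (N ζ) ⊗ eval f v))
eval-opposite-pair f α ζ u v = begin
  F (α ⊙² (u ⊕² (ζ ⊙² v))) ⊕ F (α ⊙² (u ⊕² ((-ᵢ ζ) ⊙² v)))
    ≡⟨ cong₂ _⊕_ (eval-scale f α (u ⊕² (ζ ⊙² v))) (eval-scale f α (u ⊕² ((-ᵢ ζ) ⊙² v))) ⟩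
  n ⊗ F (u ⊕² (ζ ⊙² v)) ⊕ n ⊗ F (u ⊕² ((-ᵢ ζ) ⊙² v))
    ≡⟨ sym (⊗-distribˡ-⊕ n (F (u ⊕² (ζ ⊙² v))) (F (u ⊕² ((-ᵢ ζ) ⊙² v)))) ⟩
  n ⊗ (F (u ⊕² (ζ ⊙² v)) ⊕ F (u ⊕² ((-ᵢ ζ) ⊙² v)))
    ≡⟨ cong (λ t → n ⊗ (F (u ⊕² (ζ ⊙² v)) ⊕ F (u ⊕² t))) (-ᵢ-⊙² ζ v) ⟩
  n ⊗ (F (u ⊕² (ζ ⊙² v)) ⊕ F (u ⊕² (-² (ζ ⊙² v))))
    ≡⟨ cong (n ⊗_) (eval-parallelogram f u (ζ ⊙² v)) ⟩
  n ⊗ (two ⊗ (F u ⊕ F (ζ ⊙² v)))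
    ≡⟨ cong (λ t → n ⊗ (two ⊗ (F u ⊕ t))) (eval-scale f ζ v) ⟩
  n ⊗ (two ⊗ (F u ⊕ ofℚ (N ζ) ⊗ F v)) ∎
  where
  F : ℚi² → ℚi
  F = eval f
  n : ℚi
  n = ofℚ (N α)

opposite-regions : ∀ f r s k →
  eval f (w r s k) ⊕ eval f (w r s (2 + k)) ≡ eval f (ι² r) ⊕ eval f (ι² s)
opposite-regions f r s k = begin
  F (w r s k) ⊕ F (w r s (2 + k))
    ≡⟨⟩
  F (w r s k) ⊕ F (α ⊙² (ι² r ⊕² ((iℚ ⊗ (iℚ ⊗ ζ)) ⊙² ι² s)))
    ≡⟨ cong (λ t → F (w r s k) ⊕ F (α ⊙² (ι² r ⊕² (t ⊙² ι² s)))) (iℚ-⊗-iℚ-⊗ ζ) ⟩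
  F (α ⊙² (ι² r ⊕² (ζ ⊙² ι² s))) ⊕ F (α ⊙² (ι² r ⊕² ((-ᵢ ζ) ⊙² ι² s)))
    ≡⟨ eval-opposite-pair f α ζ (ι² r) (ι² s) ⟩
  ofℚ ½ ⊗ (two ⊗ (F (ι² r) ⊕ ofℚ (N ζ) ⊗ F (ι² s)))
    ≡⟨ cong (λ q → ofℚ ½ ⊗ (two ⊗ (F (ι² r) ⊕ ofℚ q ⊗ F (ι² s)))) (N-iℚ^ k) ⟩
  ofℚ ½ ⊗ (two ⊗ (F (ι² r) ⊕ ofℚ 1ℚ ⊗ F (ι² s)))
    ≡⟨ ½-⊗-two-⊗ (F (ι² r) ⊕ ofℚ 1ℚ ⊗ F (ι² s)) ⟩
  F (ι² r) ⊕ ofℚ 1ℚ ⊗ F (ι² s)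
    ≡⟨ cong (F (ι² r) ⊕_) (⊗-identityˡ (F (ι² s))) ⟩
  F (ι² r) ⊕ F (ι² s) ∎
  where
  F : ℚi² → ℚi
  F = eval f
  α ζ : ℚi
  α = ½ +iℚ ½
  ζ = iℚ ^ᵢ k

-- The identity holds for all r and s: primitivity and the index condition only ensure that
-- the w_k lie in A².
proposition7p1 : (f : HermForm) (r s : A²) →
    Primitive r → Primitive s → SpanHasIndex2 r s →
    let F = eval f in
    ((two) ⊗ F (ι² r) ⊕ (two) ⊗ F (ι² s)
       ≡ F (w r s 1) ⊕ F (w r s 2) ⊕ F (w r s 3) ⊕ F (w r s 4))
    × (F (ι² r) ⊕ F (ι² s) ≡ F (w r s 1) ⊕ F (w r s 3))
    × (F (ι² r) ⊕ F (ι² s) ≡ F (w r s 2) ⊕ F (w r s 4))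
proposition7p1 f r s _ _ _ = all-four , sym pair₁₃ , sym pair₂₄
  where
  F : ℚi² → ℚi
  F = eval f
  pair₁₃ : F (w r s 1) ⊕ F (w r s 3) ≡ F (ι² r) ⊕ F (ι² s)
  pair₁₃ = opposite-regions f r s 1
  pair₂₄ : F (w r s 2) ⊕ F (w r s 4) ≡ F (ι² r) ⊕ F (ι² s)
  pair₂₄ = opposite-regions f r s 2
  all-four : two ⊗ F (ι² r) ⊕ two ⊗ F (ι² s)
           ≡ F (w r s 1) ⊕ F (w r s 2) ⊕ F (w r s 3) ⊕ F (w r s 4)
  all-four = begin
    two ⊗ F (ι² r) ⊕ two ⊗ F (ι² s)
      ≡⟨ sym (⊗-distribˡ-⊕ two (F (ι² r)) (F (ι² s))) ⟩
    two ⊗ (F (ι² r) ⊕ F (ι² s))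
      ≡⟨ two-⊗ (F (ι² r) ⊕ F (ι² s)) ⟩
    (F (ι² r) ⊕ F (ι² s)) ⊕ (F (ι² r) ⊕ F (ι² s))
      ≡⟨ cong₂ _⊕_ (sym pair₁₃) (sym pair₂₄) ⟩
    (F (w r s 1) ⊕ F (w r s 3)) ⊕ (F (w r s 2) ⊕ F (w r s 4))
      ≡⟨ ⊕-interchange (F (w r s 1)) (F (w r s 3)) (F (w r s 2)) (F (w r s 4)) ⟩
    F (w r s 1) ⊕ F (w r s 2) ⊕ F (w r s 3) ⊕ F (w r s 4) ∎
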